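{- There exists an absolute constant $c>0$ such that for all integers $k \geq 1$ and $n \geq 3$, every $k$-degenerate graph $G$ on $n$ vertices satisfies $\pi(G) \leq c\, k \log\log n$. (That is, $\pi(G) \in O(k \log\log n)$ for $k$-degenerate graphs $G$ on $n$ vertices.)
   Context: All graphs are finite, simple and undirected; $\log$ denotes the logarithm to base $2$. A permutation of a finite set $U$ is a bijection $\sigma: U \to [|U|]$. For disjoint $A,B \subseteq U$, write $A \prec_\sigma B$ if $\sigma(a)<\sigma(b)$ for all $a \in A$, $b \in B$; $\sigma$ separates $A$ and $B$ if $A \prec_\sigma B$ or $B \prec_\sigma A$. A family $\mathcal{F}$ of permutations of $V(G)$ is pairwise suitable for $G$ if for every two disjoint edges $e,f$ of $G$ (viewed as 2-element vertex sets) some $\sigma \in \mathcal{F}$ separates $e$ and $f$. The separation dimension $\pi(G)$ is the minimum cardinality of a family of permutations of $V(G)$ that is pairwise suitable for $G$. For a non-negative integer $k$, a graph $G$ is $k$-degenerate if its vertices can be enumerated so that every vertex is succeeded in the enumeration by at most $k$ of its neighbours. -}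

module Defs where

open import Data.Nat using (ℕ; _≤_; _<_)
open import Data.Bool using (Bool; true; false; T)
open import Data.Fin using (Fin; toℕ)
open import Data.Fin.Permutation using (Permutation′; _⟨$⟩ʳ_)
open import Data.List using (List; length; filter; allFin)
open import Data.Product using (_×_; Σ; ∃)
open import Data.Sum using (_⊎_)
open import Relation.Binary.PropositionalEquality using (_≡_; _≢_)
open import Relation.Nullary using (¬_)
open import Data.Nat.Properties using (_<?_)
open import Data.Bool using (_∧_)
open import Relation.Nullary.Decidable using (⌊_⌋)

record Graph (n : ℕ) : Set where
  field
    adj       : Fin n → Fin n → Bool
    symmetric : ∀ u v → adj u v ≡ adj v u
    irreflex  : ∀ v → adj v v ≡ false

open Graph public

Edge : ∀ {n} → Graph n → Fin n → Fin n → Set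
Edge G u v = T (adj G u v)

Perm : ℕ → Set
Perm n = Permutation′ n

Precedes : ∀ {n} → Perm n → Fin n → Fin n → Fin n → Fin n → Set
Precedes σ a b c d =
  (toℕ (σ ⟨$⟩ʳ a) < toℕ (σ ⟨$⟩ʳ c)) × (toℕ (σ ⟨$⟩ʳ a) < toℕ (σ ⟨$⟩ʳ d)) ×
  (toℕ (σ ⟨$⟩ʳ b) < toℕ (σ ⟨$⟩ʳ c)) × (toℕ (σ ⟨$⟩ʳ b) < toℕ (σ ⟨$⟩ʳ d))

Separates : ∀ {n} → Perm n → Fin n → Fin n → Fin n → Fin n → Set
Separates σ a b c d = Precedes σ a b c d ⊎ Precedes σ c d a b

DisjointEdges : ∀ {n} → Graph n → Fin n → Fin n → Fin n → Fin n → Set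
DisjointEdges G a b c d =
  Edge G a b × Edge G c d × a ≢ c × a ≢ d × b ≢ c × b ≢ d

PairwiseSuitable : ∀ {n m} → Graph n → (Fin m → Perm n) → Set
PairwiseSuitable {n} {m} G F =
  ∀ a b c d → DisjointEdges G a b c d → ∃ λ (i : Fin m) → Separates (F i) a b c d

-- π(G) ≤ t : some pairwise suitable family has cardinality at most t
-- (π(G) is the minimum such cardinality, so this is exactly π(G) ≤ t)
SepDimAtMost : ∀ {n} → Graph n → ℕ → Set
SepDimAtMost {n} G t = Σ ℕ λ m → m ≤ t × Σ (Fin m → Perm n) λ F → PairwiseSuitable G F

laterNeighbours : ∀ {n} → Graph n → Perm n → Fin n → ℕ
laterNeighbours {n} G ord v =
  length (filter (λ u → T? (adj G v u ∧ ⌊ toℕ (ord ⟨$⟩ʳ v) <? toℕ (ord ⟨$⟩ʳ u) ⌋)) (allFin n))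
  where
  open import Data.Bool.Properties using () renaming (T? to T?)

Degenerate : ∀ {n} → ℕ → Graph n → Set
Degenerate {n} k G = Σ (Perm n) λ ord → ∀ v → laterNeighbours G ord v ≤ k

module Submission where

-- Enumerate the vertices so that each has at most k later neighbours. For j < k, sending
-- every vertex to its j-th later neighbour gives a forest, and the k forests cover all
-- edges. Two-colour a forest; one colour class and the children of its vertices split the
-- vertices into stars. An edge ab of forest j, with b the parent of a, lies in the star
-- of b, and any disjoint edge cd is separated from it by ordering the stars as blocks
-- (centre first), using one of 2(⌈log₂ ⌈log₂ n⌉⌉ + 1) orders in which any vertex can be
-- put above any two others. This gives 8k(⌈log₂ ⌈log₂ n⌉⌉ + 1) permutations in total.

open import Defs
open import Data.Bool using (Bool; true; false; T; not; _∧_; _xor_; if_then_else_)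
open import Data.Bool.Properties
  using (T?; T-≡; T-∧; ¬-not; not-injective; xor-assoc; xor-comm; xor-same; xor-identityʳ; xor-inverseˡ; xor-inverseʳ)
  renaming (_≟_ to _≟ᵇ_)
open import Data.Fin using (Fin; zero; suc; toℕ; fromℕ<; inject≤; punchOut)
open import Data.Fin.Permutation using (permutation; _⟨$⟩ʳ_)
open import Data.Fin.Properties
  using (2↔Bool; *↔×; any?; inject≤-injective; injective⇒≤; punchOut-injective; toℕ-fromℕ<; toℕ-injective; toℕ<n)
  renaming (_≟_ to _≟ᶠ_)
open import Data.Fin.Subset using (Subset; _⊂_; ∣_∣) renaming (_∈_ to _∈ˢ_)
open import Data.Fin.Subset.Properties using (p⊂q⇒∣p∣<∣q∣; ∣⊤∣≡n; ∈⊤)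
open import Data.List using (List; []; _∷_; length; filter; allFin)
open import Data.List.Membership.Propositional using (_∈_)
open import Data.List.Membership.Propositional.Properties using (∈-filter⁺; ∈-filter⁻; ∈-allFin)
open import Data.List.Relation.Unary.Any using (here; there)
open import Data.Maybe using (Maybe; just; nothing; maybe′; fromMaybe)
open import Data.Nat using (ℕ; zero; suc; _+_; _*_; _∸_; _^_; _≤_; _<_; _<ᵇ_; s≤s; z≤n; ⌈_/2⌉; ⌊_/2⌋)
open import Data.Nat.Induction using (<-wellFounded)
open import Data.Nat.Logarithm using (⌈log₂_⌉; ⌈log₂⌉-mono-≤)
open import Data.Nat.Logarithm.Core using (⌈log2⌉)
open import Data.Nat.Properties
open import Data.Nat.Tactic.RingSolver using (solve-∀)
open import Data.Product using (Σ; ∃; ∃₂; _×_; _,_; proj₁; proj₂)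
open import Data.Product.Function.NonDependent.Propositional using (_×-↔_)
open import Data.Sum using (_⊎_; inj₁; inj₂)
open import Data.Vec using (Vec; []; _∷_; lookup; tabulate; replicate; zipWith)
open import Data.Vec.Properties
  using (lookup∘tabulate; lookup-replicate; lookup-zipWith; ∷-injective; []=⇒lookup; lookup⇒[]=)
open import Function using (_∘_; id)
open import Function.Bundles using (Equivalence; Injection; Inverse; _↔_)
open import Function.Definitions using (Injective)
open import Function.Properties.Inverse using (↔⇒↣; ↔-refl; ↔-trans)
open import Induction.WellFounded using (Acc; acc)
open import Relation.Binary.Definitions using (Tri; tri<; tri≈; tri>)
open import Relation.Binary.PropositionalEquality
open import Relation.Nullary using (Dec; yes; no; does; contradiction)
open import Relation.Nullary.Decidable using (⌊_⌋; toWitness; fromWitness)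

position : ∀ {n} → Perm n → Fin n → ℕ
position σ v = toℕ (σ ⟨$⟩ʳ v)

position-injective : ∀ {n} (σ : Perm n) {u v} → position σ u ≡ position σ v → u ≡ v
position-injective σ = Injection.injective (↔⇒↣ σ) ∘ toℕ-injective

PrecedesBy : ∀ {n} → (Fin n → ℕ) → Fin n → Fin n → Fin n → Fin n → Set
PrecedesBy f a b c d = (f a < f c) × (f a < f d) × (f b < f c) × (f b < f d)

-- Separates σ is definitionally SeparatesBy (position σ).
SeparatesBy : ∀ {n} → (Fin n → ℕ) → Fin n → Fin n → Fin n → Fin n → Set
SeparatesBy f a b c d = PrecedesBy f a b c d ⊎ PrecedesBy f c d a b

module _ {n} {f : Fin n → ℕ} {a b c d : Fin n} where

  SeparatesBy-swapˡ : SeparatesBy f a b c d → SeparatesBy f b a c d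
  SeparatesBy-swapˡ (inj₁ (ac , ad , bc , bd)) = inj₁ (bc , bd , ac , ad)
  SeparatesBy-swapˡ (inj₂ (ca , cb , da , db)) = inj₂ (cb , ca , db , da)

  SeparatesBy-swapʳ : SeparatesBy f a b c d → SeparatesBy f a b d c
  SeparatesBy-swapʳ (inj₁ (ac , ad , bc , bd)) = inj₁ (ad , ac , bd , bc)
  SeparatesBy-swapʳ (inj₂ (ca , cb , da , db)) = inj₂ (da , db , ca , cb)

  SeparatesBy-refine : {g : Fin n → ℕ} → (∀ {u v} → f u < f v → g u < g v) →
                       SeparatesBy f a b c d → SeparatesBy g a b c d
  SeparatesBy-refine f⇒g (inj₁ (ac , ad , bc , bd)) = inj₁ (f⇒g ac , f⇒g ad , f⇒g bc , f⇒g bd)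
  SeparatesBy-refine f⇒g (inj₂ (ca , cb , da , db)) = inj₂ (f⇒g ca , f⇒g cb , f⇒g da , f⇒g db)

injective⇒surjective : ∀ {n} {f : Fin n → Fin n} → Injective _≡_ _≡_ f → ∀ i → ∃ λ x → f x ≡ i
injective⇒surjective {suc n} {f} f-inj i with any? (λ x → f x ≟ᶠ i)
... | yes hit = hit
... | no miss = contradiction (injective⇒≤ {f = f′} f′-inj) 1+n≰n
  where
  missed : ∀ x → i ≢ f x
  missed x i≡fx = miss (x , sym i≡fx)
  f′ : Fin (suc n) → Fin n
  f′ x = punchOut (missed x)
  f′-inj : Injective _≡_ _≡_ f′
  f′-inj {x} {y} = f-inj ∘ punchOut-injective (missed x) (missed y)

injective⇒permutation : ∀ {n} (f : Fin n → Fin n) → Injective _≡_ _≡_ f → Perm n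
injective⇒permutation f f-inj = permutation f (proj₁ ∘ surj) (proj₂ ∘ surj) (λ x → f-inj (proj₂ (surj (f x))))
  where
  surj : ∀ i → ∃ λ x → f x ≡ i
  surj = injective⇒surjective f-inj

lex-< : ∀ {x x′ y y′ w} → x < x′ → y < w → x * w + y < x′ * w + y′
lex-< {x} {x′} {y} {y′} {w} x<x′ y<w = begin-strict
  x * w + y   <⟨ +-monoʳ-< (x * w) y<w ⟩
  x * w + w   ≡⟨ +-comm (x * w) w ⟩
  suc x * w   ≤⟨ *-monoˡ-≤ w x<x′ ⟩
  x′ * w      ≤⟨ m≤m+n (x′ * w) y′ ⟩
  x′ * w + y′ ∎
  where open ≤-Reasoning

lex-injectiveʳ : ∀ {x x′ y y′ w} → y < w → y′ < w → x * w + y ≡ x′ * w + y′ → y ≡ y′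
lex-injectiveʳ {x} {x′} {y} {y′} y<w y′<w eq with <-cmp x x′
... | tri< x<x′ _ _ = contradiction eq (<⇒≢ (lex-< x<x′ y<w))
... | tri≈ _ refl _ = +-cancelˡ-≡ _ y y′ eq
... | tri> _ _ x>x′ = contradiction (sym eq) (<⇒≢ (lex-< x>x′ y′<w))

module _ {n} (key : Fin n → ℕ) where

  private
    tieBroken : Fin n → ℕ
    tieBroken v = key v * n + toℕ v

    tieBroken-injective : Injective _≡_ _≡_ tieBroken
    tieBroken-injective {u} {v} = toℕ-injective ∘ lex-injectiveʳ {key u} {key v} (toℕ<n u) (toℕ<n v)

    below : Fin n → Subset n
    below v = tabulate (λ u → tieBroken u <ᵇ tieBroken v)

    ∈-below⁺ : ∀ {u v} → tieBroken u < tieBroken v → u ∈ˢ below v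
    ∈-below⁺ {u} {v} lt = lookup⇒[]= u (below v) (trans (lookup∘tabulate _ u) (Equivalence.to T-≡ (<⇒<ᵇ lt)))

    ∈-below⁻ : ∀ {u v} → u ∈ˢ below v → tieBroken u < tieBroken v
    ∈-below⁻ {u} {v} u∈ = <ᵇ⇒< _ _ (Equivalence.from T-≡ (trans (sym (lookup∘tabulate _ u)) ([]=⇒lookup u∈)))

    below-⊂ : ∀ {u v} → tieBroken u < tieBroken v → below u ⊂ below v
    below-⊂ {u} lt =
      (λ w∈ → ∈-below⁺ (<-trans (∈-below⁻ w∈) lt)) , u , ∈-below⁺ lt , λ u∈ → <-irrefl refl (∈-below⁻ u∈)

    ∣below∣<n : ∀ v → ∣ below v ∣ < n
    ∣below∣<n v = subst (∣ below v ∣ <_) (∣⊤∣≡n n)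
      (p⊂q⇒∣p∣<∣q∣ ((λ _ → ∈⊤) , v , ∈⊤ , λ v∈ → <-irrefl refl (∈-below⁻ v∈)))

    rank : Fin n → Fin n
    rank v = fromℕ< (∣below∣<n v)

    rank-monotone : ∀ {u v} → tieBroken u < tieBroken v → toℕ (rank u) < toℕ (rank v)
    rank-monotone {u} {v} lt
      rewrite toℕ-fromℕ< (∣below∣<n u) | toℕ-fromℕ< (∣below∣<n v) = p⊂q⇒∣p∣<∣q∣ (below-⊂ lt)

    rank-injective : Injective _≡_ _≡_ rank
    rank-injective {u} {v} eq with <-cmp (tieBroken u) (tieBroken v)
    ... | tri< lt _ _ = contradiction (cong toℕ eq) (<⇒≢ (rank-monotone lt))
    ... | tri≈ _ e _  = tieBroken-injective e
    ... | tri> _ _ gt = contradiction (cong toℕ (sym eq)) (<⇒≢ (rank-monotone gt))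

  sortBy : Perm n
  sortBy = injective⇒permutation rank rank-injective

  sortBy-monotone : ∀ {u v} → key u < key v → position sortBy u < position sortBy v
  sortBy-monotone lt = rank-monotone (lex-< lt (toℕ<n _))

fromBits : ∀ {m} → Vec Bool m → ℕ
fromBits []               = 0
fromBits {suc m} (b ∷ bs) = (if b then 2 ^ m else 0) + fromBits bs

fromBits<2^ : ∀ {m} (bs : Vec Bool m) → fromBits bs < 2 ^ m
fromBits<2^ []                   = s≤s z≤n
fromBits<2^ {suc m} (true  ∷ bs) = +-monoʳ-< (2 ^ m) (<-≤-trans (fromBits<2^ bs) (m≤m+n (2 ^ m) 0))
fromBits<2^ {suc m} (false ∷ bs) = <-≤-trans (fromBits<2^ bs) (m≤m+n (2 ^ m) (2 ^ m + 0))

data FirstDifference : ∀ {m} → Vec Bool m → Vec Bool m → Fin m → Set where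
  here  : ∀ {m b c} {bs cs : Vec Bool m} → b ≢ c → FirstDifference (b ∷ bs) (c ∷ cs) zero
  there : ∀ {m b i} {bs cs : Vec Bool m} → FirstDifference bs cs i → FirstDifference (b ∷ bs) (b ∷ cs) (suc i)

firstDifference : ∀ {m} {bs cs : Vec Bool m} → bs ≢ cs → ∃ (FirstDifference bs cs)
firstDifference {bs = []}     {[]}     bs≢cs = contradiction refl bs≢cs
firstDifference {bs = b ∷ bs} {c ∷ cs} bs≢cs with b ≟ᵇ c
... | no b≢c  = zero , here b≢c
... | yes refl with firstDifference (bs≢cs ∘ cong (b ∷_))
...   | i , diff = suc i , there diff

FirstDifference-sym : ∀ {m} {bs cs : Vec Bool m} {i} → FirstDifference bs cs i → FirstDifference cs bs i
FirstDifference-sym (here b≢c)  = here (b≢c ∘ sym)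
FirstDifference-sym (there diff) = there (FirstDifference-sym diff)

FirstDifference⇒lookup≢ : ∀ {m} {bs cs : Vec Bool m} {i} → FirstDifference bs cs i → lookup bs i ≢ lookup cs i
FirstDifference⇒lookup≢ (here b≢c)  = b≢c
FirstDifference⇒lookup≢ (there diff) = FirstDifference⇒lookup≢ diff

FirstDifference-xor : ∀ {m} (os : Vec Bool m) {bs cs i} → FirstDifference bs cs i →
                      FirstDifference (zipWith _xor_ os bs) (zipWith _xor_ os cs) i
FirstDifference-xor (o ∷ os) (here b≢c)  = here (b≢c ∘ xorˡ-injective o)
  where
  xorˡ-injective : ∀ o {b c} → o xor b ≡ o xor c → b ≡ c
  xorˡ-injective false = id
  xorˡ-injective true  = not-injective
FirstDifference-xor (o ∷ os) (there diff) = there (FirstDifference-xor os diff)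

-- Bits are most significant first, so the first difference decides the order.
FirstDifference⇒fromBits-< : ∀ {m} {bs cs : Vec Bool m} {i} → FirstDifference bs cs i → lookup bs i ≡ true →
                             fromBits cs < fromBits bs
FirstDifference⇒fromBits-< (here {b = true} {false} {bs} {cs} _) _ =
  <-≤-trans (fromBits<2^ cs) (m≤m+n _ (fromBits bs))
FirstDifference⇒fromBits-< (here {b = true} {true} b≢c) _ = contradiction refl b≢c
FirstDifference⇒fromBits-< (there diff) bit = +-monoʳ-< _ (FirstDifference⇒fromBits-< diff bit)

FirstDifference⇒fromBits≢ : ∀ {m} {bs cs : Vec Bool m} {i} → FirstDifference bs cs i → fromBits bs ≢ fromBits cs
FirstDifference⇒fromBits≢ {bs = bs} {i = i} diff with lookup bs i in bit
... | true  = ≢-sym (<⇒≢ (FirstDifference⇒fromBits-< diff bit))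
... | false = <⇒≢ (FirstDifference⇒fromBits-< (FirstDifference-sym diff)
                     (trans (¬-not (FirstDifference⇒lookup≢ diff ∘ sym)) (cong not bit)))

toBits : ∀ R → Fin (2 ^ R) → Vec Bool R
toBits zero    _ = []
toBits (suc R) i = let b , j = Inverse.to *↔× i in Inverse.to 2↔Bool b ∷ toBits R j

toBits-injective : ∀ R → Injective _≡_ _≡_ (toBits R)
toBits-injective zero    {zero} {zero} _ = refl
toBits-injective (suc R) eq =
  let head≡ , tail≡ = ∷-injective eq
  in  injective *↔× (cong₂ _,_ (injective 2↔Bool head≡) (toBits-injective R tail≡))
  where
  injective : ∀ {A B : Set} (f : A ↔ B) → Injective _≡_ _≡_ (Inverse.to f)
  injective f = Injection.injective (↔⇒↣ f)

binary : ∀ {n} L → n ≤ 2 ^ L → Fin n → Vec Bool L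
binary L n≤2^L v = toBits L (inject≤ v n≤2^L)

binary-injective : ∀ {n} L (n≤2^L : n ≤ 2 ^ L) → Injective _≡_ _≡_ (binary L n≤2^L)
binary-injective L n≤2^L = inject≤-injective _ _ _ _ ∘ toBits-injective L

-- A 3-suitable family: any z lies above any x, y ≢ z in one of its 2(R + 1) orders.
-- The orders compare binary codes of length L after flipping the bits selected by an
-- orientation; for the theorem L = ⌈log₂ n⌉ and R = ⌈log₂ L⌉.
module ThreeSuitable {n} L (n≤2^L : n ≤ 2 ^ L) R (L≤2^R : L ≤ 2 ^ R) where

  -- The coordinate pattern of orientation (s , suc r) is bit r of the binary index
  -- of the coordinate, so any two coordinates are distinguished by some orientation.
  orientation : Bool → Fin (suc R) → Vec Bool L
  orientation s zero    = replicate L s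
  orientation s (suc r) = tabulate (λ P → s xor lookup (binary R L≤2^R P) r)

  orientation-independent : ∀ P Q α β → (P ≡ Q → α ≡ β) →
    ∃₂ λ s r → lookup (orientation s r) P ≡ α × lookup (orientation s r) Q ≡ β
  orientation-independent P Q α β P≡Q⇒α≡β with α ≟ᵇ β
  ... | yes refl = α , zero , lookup-replicate P α , lookup-replicate Q α
  ... | no α≢β   =
    let r , diff = firstDifference (α≢β ∘ P≡Q⇒α≡β ∘ binary-injective R L≤2^R)
        c  = lookup (binary R L≤2^R P) r
        c′ = lookup (binary R L≤2^R Q) r
        open ≡-Reasoning
    in  α xor c , suc r
      , (begin
           lookup (orientation (α xor c) (suc r)) P ≡⟨ lookup∘tabulate _ P ⟩
           (α xor c) xor c                         ≡⟨ xor-assoc α c c ⟩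
           α xor (c xor c)                         ≡⟨ cong (α xor_) (xor-same c) ⟩
           α xor false                             ≡⟨ xor-identityʳ α ⟩
           α                                       ∎)
      , (begin
           lookup (orientation (α xor c) (suc r)) Q ≡⟨ lookup∘tabulate _ Q ⟩
           (α xor c) xor c′                        ≡⟨ cong ((α xor c) xor_) (¬-not (FirstDifference⇒lookup≢ diff ∘ sym)) ⟩
           (α xor c) xor not c                     ≡⟨ xor-assoc α c (not c) ⟩
           α xor (c xor not c)                     ≡⟨ cong (α xor_) (xor-inverseʳ c) ⟩
           α xor true                              ≡⟨ xor-comm α true ⟩
           not α                                   ≡⟨ ¬-not (α≢β ∘ sym) ⟨
           β                                       ∎)

  code : Fin n → Vec Bool L
  code = binary L n≤2^L

  order : Bool → Fin (suc R) → Fin n → ℕ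
  order s r v = fromBits (zipWith _xor_ (orientation s r) (code v))

  order<2^L : ∀ s r v → order s r v < 2 ^ L
  order<2^L s r v = fromBits<2^ (zipWith _xor_ (orientation s r) (code v))

  order-≢ : ∀ s r {u v} → u ≢ v → order s r u ≢ order s r v
  order-≢ s r u≢v =
    let _ , diff = firstDifference (u≢v ∘ binary-injective L n≤2^L)
    in  FirstDifference⇒fromBits≢ (FirstDifference-xor (orientation s r) diff)

  order-above : ∀ {s r z x P} → FirstDifference (code z) (code x) P →
                lookup (orientation s r) P ≡ not (lookup (code z) P) → order s r x < order s r z
  order-above {s} {r} {z} {P = P} diff flips =
    FirstDifference⇒fromBits-< (FirstDifference-xor (orientation s r) diff) (begin
      lookup (zipWith _xor_ (orientation s r) (code z)) P ≡⟨ lookup-zipWith _xor_ P (orientation s r) (code z) ⟩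
      lookup (orientation s r) P xor lookup (code z) P    ≡⟨ cong (_xor lookup (code z) P) flips ⟩
      not (lookup (code z) P) xor lookup (code z) P       ≡⟨ xor-inverseˡ (lookup (code z) P) ⟩
      true                                                ∎)
    where open ≡-Reasoning

  -- z gets bit 1 at its first difference from x and at its first difference from y.
  order-threeSuitable : ∀ {z x y} → z ≢ x → z ≢ y →
                        ∃₂ λ s r → order s r x < order s r z × order s r y < order s r z
  order-threeSuitable {z} z≢x z≢y =
    let P , diffˣ = firstDifference (z≢x ∘ binary-injective L n≤2^L)
        Q , diffʸ = firstDifference (z≢y ∘ binary-injective L n≤2^L)
        s , r , flipsP , flipsQ = orientation-independent P Q (not (lookup (code z) P)) (not (lookup (code z) Q))
                                    (cong (not ∘ lookup (code z)))
    in  s , r , order-above {s} {r} diffˣ flipsP , order-above {s} {r} diffʸ flipsQ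

nth : ∀ {A : Set} → List A → ℕ → Maybe A
nth []       _       = nothing
nth (x ∷ xs) zero    = just x
nth (x ∷ xs) (suc i) = nth xs i

nth⇒∈ : ∀ {A : Set} (xs : List A) i {y} → nth xs i ≡ just y → y ∈ xs
nth⇒∈ (x ∷ xs) zero    refl = here refl
nth⇒∈ (x ∷ xs) (suc i) eq   = there (nth⇒∈ xs i eq)

∈⇒nth : ∀ {A : Set} {xs : List A} {y} → y ∈ xs → ∃ λ i → i < length xs × nth xs i ≡ just y
∈⇒nth (here refl) = zero , s≤s z≤n , refl
∈⇒nth (there y∈xs) with ∈⇒nth y∈xs
... | i , i<len , eq = suc i , s≤s i<len , eq

-- Colours alternate along parent links. The recursion runs on fuel, and any fuel
-- exceeding the height gives the same colour.
module TwoColouring {A : Set} (parent : A → Maybe A) (height : A → ℕ)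
                    (parent-lowers : ∀ {a b} → parent a ≡ just b → height b < height a) where

  colourWith : ℕ → A → Bool
  colourWith zero    _ = false
  colourWith (suc f) a = maybe′ (not ∘ colourWith f) false (parent a)

  colourWith-stable : ∀ {f g} a → height a < f → height a < g → colourWith f a ≡ colourWith g a
  colourWith-stable {suc f} {suc g} a (s≤s h≤f) (s≤s h≤g) with parent a in eq
  ... | nothing = refl
  ... | just b  =
    cong not (colourWith-stable b (<-≤-trans (parent-lowers eq) h≤f) (<-≤-trans (parent-lowers eq) h≤g))

  colour : A → Bool
  colour a = colourWith (suc (height a)) a

  colour-parent : ∀ {a b} → parent a ≡ just b → colour a ≡ not (colour b)
  colour-parent {a} {b} eq rewrite eq = cong not (colourWith-stable b (parent-lowers eq) ≤-refl)

-- The j-th later neighbours form a forest for every j, with parents later in the order.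
module DegeneracyForests {n} (G : Graph n) (ord : Perm n) where

  private
    isLaterNeighbour : Fin n → Fin n → Bool
    isLaterNeighbour v u = adj G v u ∧ ⌊ position ord v <? position ord u ⌋

  laterNeighbourList : Fin n → List (Fin n)
  laterNeighbourList v = filter (T? ∘ isLaterNeighbour v) (allFin n)

  parent : ℕ → Fin n → Maybe (Fin n)
  parent j v = nth (laterNeighbourList v) j

  parent-later : ∀ {j v p} → parent j v ≡ just p → position ord v < position ord p
  parent-later {j} {v} {p} eq =
    let _ , later = ∈-filter⁻ (T? ∘ isLaterNeighbour v) {xs = allFin n} (nth⇒∈ (laterNeighbourList v) j eq)
    in  toWitness (proj₂ (Equivalence.to (T-∧ {adj G v p}) later))

  edge⇒parent : ∀ {a b} → Edge G a b → position ord a < position ord b →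
                ∃ λ j → j < laterNeighbours G ord a × parent j a ≡ just b
  edge⇒parent {a} {b} ab a<b = ∈⇒nth (∈-filter⁺ (T? ∘ isLaterNeighbour a) {xs = allFin n} (∈-allFin b)
                                        (Equivalence.from (T-∧ {adj G a b}) (ab , fromWitness a<b)))

  private
    height : Fin n → ℕ
    height v = n ∸ position ord v

    parent-lowers : ∀ {j v p} → parent j v ≡ just p → height p < height v
    parent-lowers {p = p} eq = ∸-monoʳ-< (parent-later eq) (<⇒≤ (toℕ<n (ord ⟨$⟩ʳ p)))

  colour : ℕ → Fin n → Bool
  colour j = TwoColouring.colour (parent j) height parent-lowers

  colour-parent : ∀ {j a b} → parent j a ≡ just b → colour j a ≡ not (colour j b)
  colour-parent {j} = TwoColouring.colour-parent (parent j) height parent-lowers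

module StarLayouts {n} (G : Graph n) (ord : Perm n) L (n≤2^L : n ≤ 2 ^ L) R (L≤2^R : L ≤ 2 ^ R) where

  open DegeneracyForests G ord
  open ThreeSuitable L n≤2^L R L≤2^R

  N : ℕ
  N = 2 ^ L

  -- Colour class δ of forest j, together with the parents of the other class,
  -- splits the vertices into stars; every vertex is sent to the centre of its star.
  centre : ℕ → Bool → Fin n → Fin n
  centre j δ v = if colour j v xor δ then fromMaybe v (parent j v) else v

  centre-self : ∀ {j δ v} → colour j v ≡ δ → centre j δ v ≡ v
  centre-self {δ = δ} refl rewrite xor-same δ = refl

  centre-parent : ∀ {j a b} → parent j a ≡ just b → centre j (colour j b) a ≡ b
  centre-parent {j} {b = b} a→b rewrite colour-parent a→b | xor-inverseˡ (colour j b) | a→b = refl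

  mirror : Bool → ℕ → ℕ
  mirror false t = t
  mirror true  t = N ∸ suc t

  mirror<N : ∀ dr {t} → t < N → mirror dr t < N
  mirror<N false t<N = t<N
  mirror<N true  t<N = ∸-monoʳ-< (s≤s z≤n) t<N

  mirror-orients : ∀ {t t′} → t ≢ t′ → t < N → ∃ λ dr → mirror dr t < mirror dr t′
  mirror-orients {t} {t′} t≢t′ t<N with <-cmp t t′
  ... | tri< t<t′ _ _ = false , t<t′
  ... | tri≈ _ t≡t′ _ = contradiction t≡t′ t≢t′
  ... | tri> _ _ t>t′ = true , ∸-monoʳ-< (s≤s t>t′) t<N

  module Layout (j : ℕ) (δ dr s : Bool) (r : Fin (suc R)) where

    within : Fin n → ℕ
    within v = if does (centre j δ v ≟ᶠ v) then 0 else suc (mirror dr (order s r v))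

    within<1+N : ∀ v → within v < suc N
    within<1+N v with centre j δ v ≟ᶠ v
    ... | yes _ = s≤s z≤n
    ... | no  _ = s≤s (mirror<N dr (order<2^L s r v))

    key : Fin n → ℕ
    key v = order s r (centre j δ v) * suc N + within v

    key-across : ∀ {u v x y} → centre j δ u ≡ x → centre j δ v ≡ y → order s r x < order s r y → key u < key v
    key-across {u} refl refl lt = lex-< lt (within<1+N u)

    key-centre-first : ∀ {u v} → centre j δ u ≡ u → centre j δ v ≡ u → v ≢ u → key u < key v
    key-centre-first {u} {v} cu cv v≢u with centre j δ u ≟ᶠ u | centre j δ v ≟ᶠ v
    ... | no  cu≢u | _        = contradiction cu cu≢u
    ... | yes _    | yes cv≡v = contradiction (trans (sym cv≡v) cv) v≢u
    ... | yes _    | no  _    rewrite cu | cv = +-monoʳ-< (order s r u * suc N) (s≤s z≤n)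

    key-leaves : ∀ {u v} → centre j δ u ≡ centre j δ v → centre j δ u ≢ u → centre j δ v ≢ v →
                 mirror dr (order s r u) < mirror dr (order s r v) → key u < key v
    key-leaves {u} {v} cu≡cv cu≢u cv≢v lt with centre j δ u ≟ᶠ u | centre j δ v ≟ᶠ v
    ... | yes cu≡u | _        = contradiction cu≡u cu≢u
    ... | no  _    | yes cv≡v = contradiction cv≡v cv≢v
    ... | no  _    | no  _    rewrite cu≡cv = +-monoʳ-< (order s r (centre j δ v) * suc N) (s≤s lt)

  -- For the edge ab of forest j, b is a centre and a lies in its star. A disjoint cd is
  -- separated according to which of c, d lie in that star: if none, that star goes last;
  -- if both, the centre b comes first and a precedes c and d in the mirrored order;
  -- if only c, the star of d goes after it and a precedes c.
  module EdgeSeparation {j a b} (a→b : parent j a ≡ just b) where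

    private
      δ : Bool
      δ = colour j b

      centre-b : centre j δ b ≡ b
      centre-b = centre-self refl

      centre-a : centre j δ a ≡ b
      centre-a = centre-parent a→b

      b≢a : b ≢ a
      b≢a b≡a = <-irrefl (cong (position ord) (sym b≡a)) (parent-later a→b)

      leaf : ∀ {v} → centre j δ v ≡ b → b ≢ v → centre j δ v ≢ v
      leaf cv b≢v cv≡v = b≢v (trans (sym cv) cv≡v)

    Separated : Fin n → Fin n → Set
    Separated c d = ∃ λ dr → ∃₂ λ s r → SeparatesBy (Layout.key j δ dr s r) a b c d

    other-stars : ∀ {c d} → centre j δ c ≢ b → centre j δ d ≢ b → Separated c d
    other-stars {c} {d} cc≢b cd≢b =
      below (order-threeSuitable {b} {centre j δ c} {centre j δ d} (cc≢b ∘ sym) (cd≢b ∘ sym))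
      where
      below : (∃₂ λ s r → order s r (centre j δ c) < order s r b × order s r (centre j δ d) < order s r b) →
              Separated c d
      below (s , r , c<b , d<b) = false , s , r , inj₂
        ( key-across refl centre-a c<b , key-across refl centre-b c<b
        , key-across refl centre-a d<b , key-across refl centre-b d<b )
        where open Layout j δ false s r

    same-star : ∀ {c d} → centre j δ c ≡ b → centre j δ d ≡ b →
                a ≢ c → a ≢ d → b ≢ c → b ≢ d → Separated c d
    same-star {c} {d} cc cd a≢c a≢d b≢c b≢d = below (order-threeSuitable {a} {c} {d} a≢c a≢d)
      where
      below : (∃₂ λ s r → order s r c < order s r a × order s r d < order s r a) → Separated c d
      below (s , r , c<a , d<a) = true , s , r , inj₁
        ( key-leaves (trans centre-a (sym cc)) (leaf centre-a b≢a) (leaf cc b≢c) (mirrored c<a)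
        , key-leaves (trans centre-a (sym cd)) (leaf centre-a b≢a) (leaf cd b≢d) (mirrored d<a)
        , key-centre-first centre-b cc (b≢c ∘ sym)
        , key-centre-first centre-b cd (b≢d ∘ sym) )
        where
        open Layout j δ true s r
        mirrored : ∀ {v} → order s r v < order s r a → mirror true (order s r a) < mirror true (order s r v)
        mirrored v<a = ∸-monoʳ-< (s≤s v<a) (order<2^L s r a)

    mixed : ∀ {c d} → centre j δ c ≡ b → centre j δ d ≢ b → a ≢ c → b ≢ c → Separated c d
    mixed {c} {d} cc cd≢b a≢c b≢c = before (order-threeSuitable {centre j δ d} {b} {b} cd≢b cd≢b)
      where
      before : (∃₂ λ s r → order s r b < order s r (centre j δ d) × order s r b < order s r (centre j δ d)) →
               Separated c d
      before (s , r , b<d , _) = inside (mirror-orients (order-≢ s r a≢c) (order<2^L s r a))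
        where
        inside : (∃ λ dr → mirror dr (order s r a) < mirror dr (order s r c)) → Separated c d
        inside (dr , a<c) = dr , s , r , inj₁
          ( key-leaves (trans centre-a (sym cc)) (leaf centre-a b≢a) (leaf cc b≢c) a<c
          , key-across centre-a refl b<d
          , key-centre-first centre-b cc (b≢c ∘ sym)
          , key-across centre-b refl b<d )
          where open Layout j δ dr s r

    separated : ∀ {c d} → a ≢ c → a ≢ d → b ≢ c → b ≢ d → Separated c d
    separated {c} {d} a≢c a≢d b≢c b≢d = by-stars (centre j δ c ≟ᶠ b) (centre j δ d ≟ᶠ b)
      where
      swap : Separated d c → Separated c d
      swap (dr , s , r , sep) = dr , s , r , SeparatesBy-swapʳ {f = Layout.key j δ dr s r} sep

      by-stars : Dec (centre j δ c ≡ b) → Dec (centre j δ d ≡ b) → Separated c d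
      by-stars (yes cc)  (yes cd)  = same-star cc cd a≢c a≢d b≢c b≢d
      by-stars (yes cc)  (no cd≢b) = mixed cc cd≢b a≢c b≢c
      by-stars (no cc≢b) (yes cd)  = swap (mixed cd cc≢b a≢d b≢d)
      by-stars (no cc≢b) (no cd≢b) = other-stars cc≢b cd≢b

  Parameters : ℕ → Set
  Parameters k = Fin k × Bool × Bool × Bool × Fin (suc R)

  layout : ∀ {k} → Parameters k → Perm n
  layout (j , δ , dr , s , r) = sortBy (Layout.key (toℕ j) δ dr s r)

  layout-separates : ∀ {k} (j : Fin k) {a b c d} (a→b : parent (toℕ j) a ≡ just b) →
                     EdgeSeparation.Separated a→b c d → ∃ λ p → Separates (layout {k} p) a b c d
  layout-separates j {b = b} _ (dr , s , r , sep) =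
    p , SeparatesBy-refine {f = key} {g = position (sortBy key)} (sortBy-monotone key) sep
    where
    key : Fin n → ℕ
    key = Layout.key (toℕ j) (colour (toℕ j) b) dr s r
    p : Parameters _
    p = j , colour (toℕ j) b , dr , s , r

  module _ {k} (degenerate : ∀ v → laterNeighbours G ord v ≤ k) {c d : Fin n} where

    edge-separated : ∀ {a b} → Edge G a b → position ord a < position ord b →
                     a ≢ c → a ≢ d → b ≢ c → b ≢ d → ∃ λ p → Separates (layout {k} p) a b c d
    edge-separated {a} {b} ab a<b a≢c a≢d b≢c b≢d = in-forest (edge⇒parent ab a<b)
      where
      in-forest : (∃ λ j → j < laterNeighbours G ord a × parent j a ≡ just b) →
                  ∃ λ p → Separates (layout {k} p) a b c d
      in-forest (j , j<deg , a→b) =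
        layout-separates (fromℕ< j<k) a→b′ (EdgeSeparation.separated a→b′ a≢c a≢d b≢c b≢d)
        where
        j<k : j < k
        j<k = <-≤-trans j<deg (degenerate a)
        a→b′ : parent (toℕ (fromℕ< j<k)) a ≡ just b
        a→b′ = subst (λ j → parent j a ≡ just b) (sym (toℕ-fromℕ< j<k)) a→b

    layouts-separate : ∀ a b → DisjointEdges G a b c d → ∃ λ p → Separates (layout {k} p) a b c d
    layouts-separate a b (ab , _ , a≢c , a≢d , b≢c , b≢d) = by-order (<-cmp (position ord a) (position ord b))
      where
      swap : (∃ λ p → Separates (layout {k} p) b a c d) → ∃ λ p → Separates (layout {k} p) a b c d
      swap (p , sep) = p , SeparatesBy-swapˡ {f = position (layout p)} sep

      by-order : Tri (position ord a < position ord b) (position ord a ≡ position ord b)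
                     (position ord b < position ord a) →
                 ∃ λ p → Separates (layout {k} p) a b c d
      by-order (tri< a<b _ _) = edge-separated ab a<b a≢c a≢d b≢c b≢d
      by-order (tri≈ _ a≡b _) =
        contradiction (subst (Edge G a) (sym (position-injective ord a≡b)) ab) (subst T (irreflex G a))
      by-order (tri> _ _ b<a) = swap (edge-separated (subst T (symmetric G a b) ab) b<a b≢c b≢d a≢c a≢d)

reindex : ∀ {n m} {A : Set} {G : Graph n} (e : Fin m ↔ A) (F : A → Perm n) →
          (∀ a b c d → DisjointEdges G a b c d → ∃ λ x → Separates (F x) a b c d) →
          PairwiseSuitable G (F ∘ Inverse.to e)
reindex e F separate a b c d disjoint =
  let x , sep = separate a b c d disjoint
  in  Inverse.from e x , subst (λ y → Separates (F y) a b c d) (sym (Inverse.strictlyInverseˡ e x)) sep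

2*↔Bool× : ∀ {m} → Fin (2 * m) ↔ (Bool × Fin m)
2*↔Bool× = ↔-trans *↔× (2↔Bool ×-↔ ↔-refl)

enumeration : ∀ k m → Fin (k * (2 * (2 * (2 * m)))) ↔ (Fin k × Bool × Bool × Bool × Fin m)
enumeration k m = ↔-trans *↔× (↔-refl ×-↔ ↔-trans 2*↔Bool× (↔-refl ×-↔ ↔-trans 2*↔Bool× (↔-refl ×-↔ 2*↔Bool×)))

n≤2^⌈log2⌉n : ∀ n (rec : Acc _<_ n) → n ≤ 2 ^ ⌈log2⌉ n rec
n≤2^⌈log2⌉n zero          _         = z≤n
n≤2^⌈log2⌉n (suc zero)    _         = ≤-refl
n≤2^⌈log2⌉n (suc (suc m)) (acc _)   = begin
  2 + m                         ≡⟨ cong (2 +_) (⌊n/2⌋+⌈n/2⌉≡n m) ⟨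
  2 + (⌊ m /2⌋ + ⌈ m /2⌉)       ≤⟨ +-monoʳ-≤ 2 (+-monoˡ-≤ ⌈ m /2⌉ (⌊n/2⌋≤⌈n/2⌉ m)) ⟩
  2 + (⌈ m /2⌉ + ⌈ m /2⌉)       ≡⟨ double ⌈ m /2⌉ ⟩
  2 * suc ⌈ m /2⌉               ≤⟨ *-monoʳ-≤ 2 (n≤2^⌈log2⌉n (suc ⌈ m /2⌉) _) ⟩
  2 * 2 ^ ⌈log2⌉ (suc ⌈ m /2⌉) _ ∎
  where
  open ≤-Reasoning
  double : ∀ x → 2 + (x + x) ≡ 2 * suc x
  double = solve-∀

n≤2^⌈log₂n⌉ : ∀ n → n ≤ 2 ^ ⌈log₂ n ⌉
n≤2^⌈log₂n⌉ n = n≤2^⌈log2⌉n n (<-wellFounded n)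

family-size : ∀ k R → 1 ≤ R → k * (2 * (2 * (2 * suc R))) ≤ 16 * k * R
family-size k R 1≤R = begin
  k * (2 * (2 * (2 * suc R)))   ≤⟨ *-monoʳ-≤ k (*-monoʳ-≤ 2 (*-monoʳ-≤ 2 (*-monoʳ-≤ 2 (+-monoˡ-≤ R 1≤R)))) ⟩
  k * (2 * (2 * (2 * (R + R)))) ≡⟨ sixteen k R ⟩
  16 * k * R                    ∎
  where
  open ≤-Reasoning
  sixteen : ∀ k R → k * (2 * (2 * (2 * (R + R)))) ≡ 16 * k * R
  sixteen = solve-∀

theorem1 : Σ ℕ λ c → 1 ≤ c × (∀ (k n : ℕ) → 1 ≤ k → 3 ≤ n → (G : Graph n) → Degenerate k G → SepDimAtMost G (c * k * ⌈log₂ ⌈log₂ n ⌉ ⌉))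
theorem1 = 16 , s≤s z≤n , λ k n _ → separation-bound k n
  where
  separation-bound : ∀ k n → 3 ≤ n → (G : Graph n) → Degenerate k G → SepDimAtMost G (16 * k * ⌈log₂ ⌈log₂ n ⌉ ⌉)
  separation-bound k n 3≤n G (ord , degenerate) =
      k * (2 * (2 * (2 * suc R)))
    , family-size k R (⌈log₂⌉-mono-≤ (⌈log₂⌉-mono-≤ 3≤n))
    , layout {k} ∘ Inverse.to (enumeration k (suc R))
    , reindex {G = G} (enumeration k (suc R)) layout (λ a b c d → layouts-separate degenerate a b)
    where
    L R : ℕ
    L = ⌈log₂ n ⌉
    R = ⌈log₂ L ⌉
    open StarLayouts G ord L (n≤2^⌈log₂n⌉ n) R (n≤2^⌈log₂n⌉ L)
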